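{- Every connected graph $H$ that has a strongly beneficial set $B$ with $B\cap U(H)\neq\emptyset$ has a control pair.
   Context: All graphs are finite, simple and undirected. For an edge set $F$, $V(F)$ is the set of endpoints of edges in $F$. An edge dominating set of a graph $G$ is a set $F\subseteq E(G)$ such that every edge of $G$ shares an endpoint with an edge of $F$; $\mathrm{MEDS}(G)$ is its minimum size. For a graph $G$, a vertex $v$ is extendable if $\mathrm{MEDS}(G-v)+1=\mathrm{MEDS}(G)$; $Q(G)$ is the set of extendable vertices. For a connected graph $H=(V,E)$: a set $Y\subseteq Q(H)$ is free if for every $v\in Y$ and every minimum edge dominating set $F$ of $H$ there is a minimum edge dominating set $F'$ of $H-v$ with $|F'|=|F|-1$ and $V(F)\setminus Y\subseteq V(F')$; $W(H)$ is the maximum free set. A vertex $v$ is uncovered if $v\notin V(F)$ for every minimum edge dominating set $F$ of $H$; $U(H)$ is the set of uncovered vertices. $\mathrm{cost}(Y)=|Y|+\mathrm{MEDS}(H-Y)-\mathrm{MEDS}(H)$. A set $B\subseteq V\setminus W(H)$ is beneficial if $\mathrm{MEDS}(H-B)<\mathrm{MEDS}(H-\tilde B)$ for every $\tilde B\subsetneq B$; strongly beneficial if moreover $\mathrm{cost}(B)<\sum_{i=1}^h\mathrm{cost}(B_i)$ for every family of proper subsets $B_1,\dots,B_h$ of $B$ with union $B$. For $B\subseteq V$, $C\subseteq V\setminus(Q(H)\cup B)$, the pair $(C,B)$ is a control pair if: $B$ is strongly beneficial; $C\cap Q(H-B)=\emptyset$; some minimum edge dominating set $F$ of $H$ has $C\subseteq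 V(F)$; and no minimum edge dominating set $F_B$ of $H-B$ has $C\subseteq V(F_B)$. -}

module Defs where

open import Data.Bool using (Bool; true; false; T)
open import Data.Nat as ℕ using (ℕ; suc; _≤_)
open import Data.Integer as ℤ using (ℤ; +_)
open import Data.Fin using (Fin)
import Data.Fin as Fin
open import Data.Fin.Subset using (Subset; ⊤; _∈_; _∉_; _∩_; _─_; _-_; _⊂_; ⋃; ∣_∣; Nonempty; Empty)
open import Data.List using (List; []; _∷_; length; foldr)
open import Data.List.Relation.Unary.All using (All)
open import Data.List.Relation.Unary.Any using (Any)
open import Data.List.Relation.Unary.Unique.Propositional using (Unique)
open import Data.List.Relation.Binary.Pointwise using (Pointwise)
open import Data.List.Membership.Propositional using () renaming (_∈_ to _∈ₗ_)
open import Data.Product using (Σ; ∃; ∃₂; _×_; _,_)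
open import Data.Sum using (_⊎_)
open import Relation.Binary.PropositionalEquality using (_≡_)
open import Relation.Nullary using (¬_)

record Graph (n : ℕ) : Set where
  field
    adj    : Fin n → Fin n → Bool
    sym    : ∀ i j → adj i j ≡ adj j i
    irrefl : ∀ i → adj i i ≡ false
open Graph public

data Reach {n : ℕ} (G : Graph n) (u : Fin n) : Fin n → Set where
  here : Reach G u u
  step : ∀ {v w} → Reach G u v → T (adj G v w) → Reach G u w

Connected : ∀ {n} → Graph n → Set
Connected {n} G = ∀ (u v : Fin n) → Reach G u v

-- Induced subgraphs G[S] for S ⊆ V(G).  Vertex deletion H - Y is the
-- induced subgraph on S ─ Y.  The graph H itself is G[⊤].

Edge : ℕ → Set
Edge n = Fin n × Fin n

-- (i , j) is an edge of G[S], written with i < j so each edge has a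
-- unique representation.
IsEdge : ∀ {n} → Graph n → Subset n → Edge n → Set
IsEdge G S (i , j) = (i Fin.< j) × T (adj G i j) × i ∈ S × j ∈ S

IsEdgeSet : ∀ {n} → Graph n → Subset n → List (Edge n) → Set
IsEdgeSet G S F = All (IsEdge G S) F × Unique F

Incident : ∀ {n} → Fin n → Edge n → Set
Incident v (a , b) = (v ≡ a) ⊎ (v ≡ b)

InV : ∀ {n} → Fin n → List (Edge n) → Set
InV v F = Any (Incident v) F

ShareEndpoint : ∀ {n} → Edge n → Edge n → Set
ShareEndpoint (i , j) f = Incident i f ⊎ Incident j f

IsEDS : ∀ {n} → Graph n → Subset n → List (Edge n) → Set
IsEDS G S F = IsEdgeSet G S F ×
  (∀ e → IsEdge G S e → Any (ShareEndpoint e) F)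

IsMinEDS : ∀ {n} → Graph n → Subset n → List (Edge n) → Set
IsMinEDS G S F = IsEDS G S F ×
  (∀ F' → IsEDS G S F' → length F ≤ length F')

MEDS : ∀ {n} → Graph n → Subset n → ℕ → Set
MEDS G S k = ∃ λ F → IsMinEDS G S F × length F ≡ k

Extendable : ∀ {n} → Graph n → Subset n → Fin n → Set
Extendable G S v = v ∈ S × ∃₂ λ k m →
  MEDS G (S - v) k × MEDS G S m × suc k ≡ m

Free : ∀ {n} → Graph n → Subset n → Set
Free G Y =
  (∀ v → v ∈ Y → Extendable G ⊤ v) ×
  (∀ v → v ∈ Y → ∀ F → IsMinEDS G ⊤ F →
     ∃ λ F' → IsMinEDS G (⊤ - v) F' × suc (length F') ≡ length F ×
       (∀ u → InV u F → u ∉ Y → InV u F'))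

IsMaxFree : ∀ {n} → Graph n → Subset n → Set
IsMaxFree G W = Free G W × (∀ Y → Free G Y → Data.Fin.Subset._⊆_ Y W)

Uncovered : ∀ {n} → Graph n → Fin n → Set
Uncovered G v = ∀ F → IsMinEDS G ⊤ F → ¬ InV v F

Cost : ∀ {n} → Graph n → Subset n → ℤ → Set
Cost G Y c = ∃₂ λ m m' → MEDS G ⊤ m × MEDS G (⊤ ─ Y) m' ×
  c ≡ (+ ∣ Y ∣ ℤ.+ + m') ℤ.- + m

sumℤ : List ℤ → ℤ
sumℤ = foldr ℤ._+_ (+ 0)

Beneficial : ∀ {n} → Graph n → Subset n → Set
Beneficial G B =
  (∀ W → IsMaxFree G W → Empty (B ∩ W)) ×
  (∀ B' → B' ⊂ B → ∀ k k' → MEDS G (⊤ ─ B) k → MEDS G (⊤ ─ B') k' → k ℕ.< k')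

StronglyBeneficial : ∀ {n} → Graph n → Subset n → Set
StronglyBeneficial G B = Beneficial G B ×
  (∀ (Bs : List (Subset _)) → All (_⊂ B) Bs → ⋃ Bs ≡ B →
     ∀ c cs → Cost G B c → Pointwise (Cost G) Bs cs → c ℤ.< sumℤ cs)

ControlPair : ∀ {n} → Graph n → Subset n → Subset n → Set
ControlPair G C B =
  StronglyBeneficial G B ×
  (∀ v → v ∈ C → ¬ Extendable G ⊤ v × v ∉ B) ×
  (∀ v → v ∈ C → ¬ Extendable G (⊤ ─ B) v) ×
  (∃ λ F → IsMinEDS G ⊤ F × (∀ v → v ∈ C → InV v F)) ×
  (∀ FB → IsMinEDS G (⊤ ─ B) FB → ¬ (∀ v → v ∈ C → InV v FB))

-- Let v ∈ B be uncovered, B₀ = B ∖ {v}, and C the neighbours of v outside B;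
-- then (C , B) is a control pair.  Every minimum edge dominating set of H
-- avoids v, so it covers all neighbours of v, and a neighbour u extendable in H
-- would give a minimum set uv ∪ F' (F' minimum for H - u) containing v.  In
-- H - B, an extendable u ∈ C gives an edge dominating set uv ∪ F' of H - B₀ of
-- size MEDS(H - B), and a minimum set of H - B covering C already dominates
-- H - B₀; both contradict MEDS(H - B) < MEDS(H - B₀), which holds as B is
-- beneficial.
module Submission where

open import Defs
open import Data.Nat using (ℕ)
open import Data.Fin using (Fin)
open import Data.Fin.Subset using (Subset; _∈_)
open import Data.Product using (∃; ∃₂; _×_)

open import Data.Bool using (Bool; T)
open import Data.Bool.Properties using (T-≡)
open import Data.Fin using (_≟_; _<?_)
open import Data.Fin.Properties using (<-cmp; any?)
open import Data.Fin.Subset using (⊤; _─_; _-_; ⁅_⁆; _∉_; _⊆_; _⊂_)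
open import Data.Fin.Subset.Properties
  using (_∈?_; ∈⊤; x∈⁅x⁆; x∈p∧x∉q⇒x∈p─q; x∈p∧x≢y⇒x∈p-y; p─q⊆p; x∈p⇒p-x⊂p)
open import Data.List using (List; _∷_; length; filter; cartesianProduct; allFin)
open import Data.List.Membership.Propositional.Properties
  using (∈-filter⁺; ∈-cartesianProduct⁺; ∈-allFin)
open import Data.List.Relation.Unary.All as All using (all?)
open import Data.List.Relation.Unary.All.Properties using (all-filter)
open import Data.List.Relation.Unary.Any as Any using (Any; here; there)
open import Data.List.Relation.Unary.Any.Properties using (Any-⊎⁻)
open import Data.List.Relation.Unary.AllPairs using (_∷_)
open import Data.List.Relation.Unary.Unique.DecPropositional using (unique?)
open import Data.List.Relation.Unary.Unique.Propositional.Properties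
  using (filter⁺; cartesianProduct⁺; allFin⁺)
open import Data.Nat using (zero; suc; _+_; _≤_; _<_)
open import Data.Nat.Properties using (+-suc; +-identityʳ; ≮⇒≥; m<1+n⇒m<n∨m≡n; <-≤-trans; <-irrefl)
open import Data.Product using (_,_)
open import Data.Product.Properties using (≡-dec)
open import Data.Sum using (_⊎_; inj₁; inj₂; swap)
open import Data.Vec as Vec using (Vec; []; _∷_; tabulate; toList; fromList)
open import Data.Vec.Properties using (length-toList; toList∘fromList; []=⇒lookup; lookup⇒[]=; lookup∘tabulate)
open import Function using (_∘_; _⇔_; mk⇔; Equivalence)
open import Relation.Binary using (tri<; tri≈; tri>)
open import Relation.Binary.PropositionalEquality as ≡ using (_≡_; _≢_; refl; trans; subst)
open import Relation.Nullary using (¬_; Dec; yes; no; contradiction)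
open import Relation.Nullary.Decidable using (map′; ¬?; _×-dec_; _⊎-dec_; _→-dec_; T?; decidable-stable)
open import Relation.Unary using (Decidable)

private
  variable
    n : ℕ
    A B : Set

x∈p─q⇒x∉q : ∀ {x : Fin n} (p q : Subset n) → x ∈ p ─ q → x ∉ q
x∈p─q⇒x∉q (_ ∷ _) (_ ∷ _) (Vec.there x∈p─q) (Vec.there x∈q) = x∈p─q⇒x∉q _ _ x∈p─q x∈q

x∈p-y⇒x≢y : ∀ {x : Fin n} (p : Subset n) y → x ∈ p - y → x ≢ y
x∈p-y⇒x≢y p y x∈p-y refl = x∈p─q⇒x∉q p ⁅ y ⁆ x∈p-y (x∈⁅x⁆ y)

x∉p⇒x∈⊤─p : ∀ {x : Fin n} {p : Subset n} → x ∉ p → x ∈ ⊤ ─ p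
x∉p⇒x∈⊤─p = x∈p∧x∉q⇒x∈p─q ∈⊤

⊤─p⊆⊤─[p-y] : ∀ (p : Subset n) y → ⊤ ─ p ⊆ ⊤ ─ (p - y)
⊤─p⊆⊤─[p-y] p y x∈ = x∉p⇒x∈⊤─p (x∈p─q⇒x∉q ⊤ p x∈ ∘ p─q⊆p p ⁅ y ⁆)

x∈⊤─[p-y]⇒x∈⊤─p : ∀ {x : Fin n} (p : Subset n) y → x ∈ ⊤ ─ (p - y) → x ≢ y → x ∈ ⊤ ─ p
x∈⊤─[p-y]⇒x∈⊤─p p y x∈ x≢y = x∉p⇒x∈⊤─p (x∈p─q⇒x∉q ⊤ (p - y) x∈ ∘ λ x∈p → x∈p∧x≢y⇒x∈p-y x∈p x≢y)

y∈⊤─[p-y] : ∀ (p : Subset n) y → y ∈ ⊤ ─ (p - y)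
y∈⊤─[p-y] p y = x∉p⇒x∈⊤─p (λ y∈p-y → x∈p-y⇒x≢y p y y∈p-y refl)

x∈tabulate⇔T : ∀ (f : Fin n → Bool) {x} → x ∈ tabulate f ⇔ T (f x)
x∈tabulate⇔T f {x} = mk⇔
  (λ x∈ → Equivalence.from T-≡ (trans (≡.sym (lookup∘tabulate f x)) ([]=⇒lookup x∈)))
  (λ fx → lookup⇒[]= x _ (trans (lookup∘tabulate f x) (Equivalence.to T-≡ fx)))

∃-least : ∀ {P : ℕ → Set} → Decidable P → ∀ {m} → P m →
          ∃ λ k → P k × (∀ {j} → P j → k ≤ j)
∃-least {P} P? {m} pm = search m 0 (λ ()) (subst P (≡.sym (+-identityʳ m)) pm)
  where
  search : ∀ d k → (∀ {j} → j < k → ¬ P j) → P (d + k) →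
           ∃ λ k → P k × (∀ {j} → P j → k ≤ j)
  search d k below p with P? k
  ... | yes pk = k , pk , λ pj → ≮⇒≥ (λ j<k → below j<k pj)
  search zero    k below p | no ¬pk = contradiction p ¬pk
  search (suc d) k below p | no ¬pk =
    search d (suc k) below′ (subst P (≡.sym (+-suc d k)) p)
    where
    below′ : ∀ {j} → j < suc k → ¬ P j
    below′ j<1+k with m<1+n⇒m<n∨m≡n j<1+k
    ... | inj₁ j<k  = below j<k
    ... | inj₂ refl = ¬pk

Searchable : Set → Set₁
Searchable A = ∀ {P : A → Set} → Decidable P → Dec (∃ P)

searchable⇒all? : Searchable A → ∀ {P : A → Set} → Decidable P → Dec (∀ x → P x)
searchable⇒all? search P? with search (¬? ∘ P?)
... | yes (x , ¬px) = no λ all → ¬px (all x)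
... | no ∄¬P        = yes λ x → decidable-stable (P? x) (λ ¬px → ∄¬P (x , ¬px))

×-searchable : Searchable A → Searchable B → Searchable (A × B)
×-searchable searchA searchB P? =
  map′ (λ (a , b , p) → (a , b) , p) (λ ((a , b) , p) → a , b , p)
       (searchA λ a → searchB λ b → P? (a , b))

Vec-searchable : Searchable A → ∀ k → Searchable (Vec A k)
Vec-searchable search zero    P? = map′ ([] ,_) (λ { ([] , p) → p }) (P? [])
Vec-searchable search (suc k) P? =
  map′ (λ (a , as , p) → a ∷ as , p) (λ { ((a ∷ as) , p) → a , as , p })
       (search λ a → Vec-searchable search k λ as → P? (a ∷ as))

adj-sym : ∀ (G : Graph n) {u v} → T (adj G u v) → T (adj G v u)
adj-sym G {u} {v} = subst T (Graph.sym G u v)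

adj⇒≢ : ∀ (G : Graph n) {u v} → T (adj G u v) → u ≢ v
adj⇒≢ G {u} uv refl = subst T (irrefl G u) uv

edge : Fin n → Fin n → Edge n
edge u v with <-cmp u v
... | tri> _ _ _ = v , u
... | _          = u , v

edge-incidentˡ : ∀ (u v : Fin n) → Incident u (edge u v)
edge-incidentˡ u v with <-cmp u v
... | tri< _ _ _ = inj₁ refl
... | tri≈ _ _ _ = inj₁ refl
... | tri> _ _ _ = inj₂ refl

edge-incidentʳ : ∀ (u v : Fin n) → Incident v (edge u v)
edge-incidentʳ u v with <-cmp u v
... | tri< _ _ _ = inj₂ refl
... | tri≈ _ _ _ = inj₂ refl
... | tri> _ _ _ = inj₁ refl

edge-isEdge : ∀ (G : Graph n) {S u v} → T (adj G u v) → u ∈ S → v ∈ S → IsEdge G S (edge u v)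
edge-isEdge G {u = u} {v} uv u∈S v∈S with <-cmp u v
... | tri< u<v _ _ = u<v , uv , u∈S , v∈S
... | tri≈ _ u≡v _ = contradiction u≡v (adj⇒≢ G uv)
... | tri> _ _ v<u = v<u , adj-sym G uv , v∈S , u∈S

shareEndpoint-edge⁻ : ∀ (u v : Fin n) {f} → ShareEndpoint (edge u v) f → Incident u f ⊎ Incident v f
shareEndpoint-edge⁻ u v s with <-cmp u v
... | tri< _ _ _ = s
... | tri≈ _ _ _ = s
... | tri> _ _ _ = swap s

isEdge-mono : ∀ (G : Graph n) {R S} → R ⊆ S → ∀ {e} → IsEdge G R e → IsEdge G S e
isEdge-mono G R⊆S (i<j , ij , i∈R , j∈R) = i<j , ij , R⊆S i∈R , R⊆S j∈R

isEdge⇒endpoint∈ : ∀ (G : Graph n) {S x e} → IsEdge G S e → Incident x e → x ∈ S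
isEdge⇒endpoint∈ G (_ , _ , i∈S , _) (inj₁ refl) = i∈S
isEdge⇒endpoint∈ G (_ , _ , _ , j∈S) (inj₂ refl) = j∈S

addEdge-isEDS : ∀ (G : Graph n) {R S u v F} → IsEDS G R F → R ⊆ S → u ∉ R → u ∈ S → v ∈ S →
                T (adj G u v) → (∀ {x} → x ∈ S → x ≢ u → x ≢ v → x ∈ R) →
                IsEDS G S (edge u v ∷ F)
addEdge-isEDS G {R} {S} {u} {v} {F} ((F⊆R , unique) , dominates) R⊆S u∉R u∈S v∈S uv rest =
  (edge-isEdge G uv u∈S v∈S All.∷ All.map (isEdge-mono G R⊆S) F⊆R , All.map edge≢ F⊆R ∷ unique) ,
  dominated
  where
  edge≢ : ∀ {f} → IsEdge G R f → edge u v ≢ f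
  edge≢ f∈R refl = u∉R (isEdge⇒endpoint∈ G f∈R (edge-incidentˡ u v))

  endpoint? : ∀ x → Incident x (edge u v) ⊎ (x ≢ u × x ≢ v)
  endpoint? x with x ≟ u | x ≟ v
  ... | yes refl | _        = inj₁ (edge-incidentˡ u v)
  ... | _        | yes refl = inj₁ (edge-incidentʳ u v)
  ... | no x≢u   | no x≢v   = inj₂ (x≢u , x≢v)

  dominated : ∀ e → IsEdge G S e → Any (ShareEndpoint e) (edge u v ∷ F)
  dominated (i , j) (i<j , ij , i∈S , j∈S) with endpoint? i | endpoint? j
  ... | inj₁ i∼uv | _ = here (inj₁ i∼uv)
  ... | _ | inj₁ j∼uv = here (inj₂ j∼uv)
  ... | inj₂ (i≢u , i≢v) | inj₂ (j≢u , j≢v) =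
    there (dominates (i , j) (i<j , ij , rest i∈S i≢u i≢v , rest j∈S j≢u j≢v))

addVertex-isEDS : ∀ (G : Graph n) {R S v F} → IsEDS G R F → R ⊆ S → (∀ {x} → x ∈ S → x ≢ v → x ∈ R) →
                  (∀ {x} → x ∈ S → T (adj G v x) → InV x F) → IsEDS G S F
addVertex-isEDS G {R} {S} {v} {F} ((F⊆R , unique) , dominates) R⊆S rest covered =
  (All.map (isEdge-mono G R⊆S) F⊆R , unique) , dominated
  where
  dominated : ∀ e → IsEdge G S e → Any (ShareEndpoint e) F
  dominated (i , j) (i<j , ij , i∈S , j∈S) with i ≟ v | j ≟ v
  ... | yes refl | _        = Any.map inj₂ (covered j∈S ij)
  ... | _        | yes refl = Any.map inj₁ (covered i∈S (adj-sym G ij))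
  ... | no i≢v   | no j≢v   = dominates (i , j) (i<j , ij , rest i∈S i≢v , rest j∈S j≢v)

∉V⇒neighbour∈V : ∀ (G : Graph n) {S F u v} → IsEDS G S F → ¬ InV v F → v ∈ S → u ∈ S →
                 T (adj G v u) → InV u F
∉V⇒neighbour∈V G {u = u} {v} (_ , dominates) v∉F v∈S u∈S vu
  with Any-⊎⁻ (Any.map (shareEndpoint-edge⁻ v u) (dominates (edge v u) (edge-isEdge G vu v∈S u∈S)))
... | inj₁ v∈F = contradiction v∈F v∉F
... | inj₂ u∈F = u∈F

module _ (G : Graph n) (S : Subset n) where

  isEdge? : Decidable (IsEdge G S)
  isEdge? (i , j) = i <? j ×-dec T? (adj G i j) ×-dec i ∈? S ×-dec j ∈? S

  incident? : ∀ x → Decidable (Incident {n} x)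
  incident? x (i , j) = x ≟ i ⊎-dec x ≟ j

  shareEndpoint? : ∀ e → Decidable (ShareEndpoint {n} e)
  shareEndpoint? (i , j) f = incident? i f ⊎-dec incident? j f

  edge-searchable : Searchable (Edge n)
  edge-searchable = ×-searchable any? any?

  isEDS? : Decidable (IsEDS G S)
  isEDS? F = (all? isEdge? F ×-dec unique? (≡-dec _≟_ _≟_) F) ×-dec
             searchable⇒all? edge-searchable (λ e → isEdge? e →-dec Any.any? (shareEndpoint? e) F)

  private
    pairs : List (Edge n)
    pairs = cartesianProduct (allFin n) (allFin n)

  allEdges : List (Edge n)
  allEdges = filter isEdge? pairs

  allEdges-isEDS : IsEDS G S allEdges
  allEdges-isEDS =
    (all-filter isEdge? pairs , filter⁺ isEdge? {pairs} (cartesianProduct⁺ (allFin⁺ n) (allFin⁺ n))) ,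
    λ { (i , j) ij → Any.map (λ { refl → inj₁ (inj₁ refl) })
                             (∈-filter⁺ isEdge? (∈-cartesianProduct⁺ (∈-allFin i) (∈-allFin j)) ij) }

  EDSOfSize : ℕ → Set
  EDSOfSize k = ∃ λ (es : Vec (Edge n) k) → IsEDS G S (toList es)

  isEDS⇒EDSOfSize : ∀ {F} → IsEDS G S F → EDSOfSize (length F)
  isEDS⇒EDSOfSize {F} F-eds = fromList F , subst (IsEDS G S) (≡.sym (toList∘fromList F)) F-eds

  minEDS : ∃ (IsMinEDS G S)
  minEDS with ∃-least (λ k → Vec-searchable edge-searchable k (isEDS? ∘ toList))
                      (isEDS⇒EDSOfSize allEdges-isEDS)
  ... | _ , (es , es-eds) , least =
    toList es , es-eds , λ F F-eds → subst (_≤ length F) (≡.sym (length-toList es)) (least (isEDS⇒EDSOfSize F-eds))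

  meds : ∃ (MEDS G S)
  meds = let F , F-min = minEDS in length F , F , F-min , refl

MEDS⇒isMinEDS : ∀ (G : Graph n) {S F} → MEDS G S (length F) → IsEDS G S F → IsMinEDS G S F
MEDS⇒isMinEDS G (F₀ , (_ , F₀-min) , ∣F₀∣≡∣F∣) F-eds =
  F-eds , λ F′ F′-eds → subst (_≤ length F′) ∣F₀∣≡∣F∣ (F₀-min F′ F′-eds)

beneficial⇒MEDS<length : ∀ (G : Graph n) {B B′ k F} → Beneficial G B → B′ ⊂ B →
                         MEDS G (⊤ ─ B) k → IsEDS G (⊤ ─ B′) F → k < length F
beneficial⇒MEDS<length G {B′ = B′} (_ , shrinking-increases) B′⊂B k-meds F-eds
  with meds G (⊤ ─ B′)
... | _ , k′-meds@(_ , (_ , F′-min) , refl) =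
  <-≤-trans (shrinking-increases B′ B′⊂B _ _ k-meds k′-meds) (F′-min _ F-eds)

neighbours : Graph n → Fin n → Subset n
neighbours G v = tabulate (adj G v)

uncovered⇒neighbours∈V : ∀ (G : Graph n) {v u F} → Uncovered G v → IsMinEDS G ⊤ F →
                         T (adj G v u) → InV u F
uncovered⇒neighbours∈V G unc F-min@(F-eds , _) = ∉V⇒neighbour∈V G F-eds (unc _ F-min) ∈⊤ ∈⊤

uncovered⇒neighbour-not-extendable : ∀ (G : Graph n) {v u} → Uncovered G v → T (adj G v u) →
                                     ¬ Extendable G ⊤ u
uncovered⇒neighbour-not-extendable G {v} {u} unc vu
  (_ , _ , _ , (F , (F-eds , _) , refl) , m-meds , refl) =
  unc (edge u v ∷ F) (MEDS⇒isMinEDS G m-meds uvF-eds) (here (edge-incidentʳ u v))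
  where
  uvF-eds : IsEDS G ⊤ (edge u v ∷ F)
  uvF-eds = addEdge-isEDS G F-eds (λ _ → ∈⊤) (λ u∈ → x∈p-y⇒x≢y ⊤ u u∈ refl) ∈⊤ ∈⊤ (adj-sym G vu)
                          (λ _ x≢u _ → x∈p∧x≢y⇒x∈p-y ∈⊤ x≢u)

beneficial⇒neighbour-not-extendable : ∀ (G : Graph n) {B v u} → Beneficial G B → v ∈ B →
                                      T (adj G v u) → ¬ Extendable G (⊤ ─ B) u
beneficial⇒neighbour-not-extendable G {B} {v} {u} ben v∈B vu
  (u∈ , _ , _ , (F , (F-eds , _) , refl) , m-meds , refl) =
  <-irrefl refl (beneficial⇒MEDS<length G ben (x∈p⇒p-x⊂p v∈B) m-meds uvF-eds)
  where
  uvF-eds : IsEDS G (⊤ ─ (B - v)) (edge u v ∷ F)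
  uvF-eds = addEdge-isEDS G F-eds (⊤─p⊆⊤─[p-y] B v ∘ p─q⊆p _ ⁅ u ⁆)
                          (λ u∈ → x∈p-y⇒x≢y (⊤ ─ B) u u∈ refl)
                          (⊤─p⊆⊤─[p-y] B v u∈) (y∈⊤─[p-y] B v) (adj-sym G vu)
                          (λ x∈ x≢u x≢v → x∈p∧x≢y⇒x∈p-y (x∈⊤─[p-y]⇒x∈⊤─p B v x∈ x≢v) x≢u)

beneficial⇒neighbours∉V : ∀ (G : Graph n) {B v F} → Beneficial G B → v ∈ B →
                          IsMinEDS G (⊤ ─ B) F → ¬ (∀ {u} → T (adj G v u) → u ∉ B → InV u F)
beneficial⇒neighbours∉V G {B} {v} {F} ben v∈B F-min@(F-eds , _) covers =
  <-irrefl refl (beneficial⇒MEDS<length G ben (x∈p⇒p-x⊂p v∈B) (F , F-min , refl) F-eds′)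
  where
  F-eds′ : IsEDS G (⊤ ─ (B - v)) F
  F-eds′ = addVertex-isEDS G F-eds (⊤─p⊆⊤─[p-y] B v) (x∈⊤─[p-y]⇒x∈⊤─p B v)
             λ x∈ vx → covers vx (x∈p─q⇒x∉q ⊤ B (x∈⊤─[p-y]⇒x∈⊤─p B v x∈ (adj⇒≢ G vx ∘ ≡.sym)))

lemma15 : ∀ (n : ℕ) (G : Graph n) → Connected G →
    ∀ (B : Subset n) → StronglyBeneficial G B →
    (∃ λ v → v ∈ B × Uncovered G v) →
    ∃₂ λ C B' → ControlPair G C B'
lemma15 n G _ B sb@(ben , _) (v , v∈B , unc) with minEDS G ⊤
... | F , F-min =
  C , B , sb ,
  (λ u u∈C → uncovered⇒neighbour-not-extendable G unc (adjacent u∈C) , outside u∈C) ,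
  (λ u u∈C → beneficial⇒neighbour-not-extendable G ben v∈B (adjacent u∈C)) ,
  (F , F-min , λ u u∈C → uncovered⇒neighbours∈V G unc F-min (adjacent u∈C)) ,
  (λ FB FB-min covers → beneficial⇒neighbours∉V G ben v∈B FB-min λ vu u∉B →
     covers _ (x∈p∧x∉q⇒x∈p─q (Equivalence.from (x∈tabulate⇔T (adj G v)) vu) u∉B))
  where
  C : Subset n
  C = neighbours G v ─ B

  adjacent : ∀ {u} → u ∈ C → T (adj G v u)
  adjacent = Equivalence.to (x∈tabulate⇔T (adj G v)) ∘ p─q⊆p _ B

  outside : ∀ {u} → u ∈ C → u ∉ B
  outside = x∈p─q⇒x∉q _ B
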